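{- For every nonnegative integer $i$, the symmetric function $$s_{(i+3,i)/(1)}\,s_{(i+1)}\;-\;s_{(i+2,i+1)}\,s_{(i)}$$ is Schur-positive, i.e. its (unique) expansion as a linear combination of Schur functions $s_\lambda$ has all coefficients nonnegative.
   Context: Work with symmetric functions in infinitely many variables $x=(x_1,x_2,\dots)$. For $m\ge1$ let $h_m=\sum_{1\le i_1\le\cdots\le i_m}x_{i_1}\cdots x_{i_m}$ be the complete homogeneous symmetric function, with $h_0=1$ and $h_m=0$ for $m<0$. For partitions $\lambda=(\lambda_1\ge\cdots\ge\lambda_r\ge 0)$ and $\mu=(\mu_1\ge\cdots\ge\mu_r\ge0)$ (padded with zeros to the same length $r$) with $\mu_j\le\lambda_j$ for all $j$, the skew Schur function is $s_{\lambda/\mu}=\det\big[h_{\lambda_i-\mu_j-i+j}\big]_{i,j=1}^{r}$, and the Schur function is $s_\lambda=s_{\lambda/\emptyset}$ (so $s_{(k)}=h_k$ and $s_{(0)}=1$). The Schur functions $s_\lambda$ form a basis of the ring of symmetric functions; a symmetric function is Schur-positive if all coefficients in its expansion in this basis are nonnegative. -}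

module Defs where

open import Data.Nat as ℕ using (ℕ; zero; suc; _≥_; _≤?_)
open import Data.Integer as ℤ using (ℤ; +_; -[1+_]; +0)
open import Data.Fin using (Fin; zero; suc; toℕ; punchIn)
open import Data.List using (List; []; _∷_; _++_; map; concatMap; foldr; length; replicate; lookup)
open import Data.List.Properties using (≡-dec)
open import Data.Product using (_×_; _,_; proj₁; proj₂)
open import Relation.Binary.PropositionalEquality using (_≡_)
open import Relation.Nullary using (yes; no)

-- The ring of symmetric functions, modelled as the polynomial ring
-- ℤ[h₁, h₂, …] (the h_m are algebraically independent generators).
-- A monomial h_{a₁}⋯h_{a_k} is stored as the ascending list [a₁,…,a_k]
-- of positive integers; a polynomial is a finite formal sum of
-- (monomial , integer coefficient) pairs.

Mono : Set
Mono = List ℕ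

Sym : Set
Sym = List (Mono × ℤ)

insertMono : ℕ → Mono → Mono
insertMono x [] = x ∷ []
insertMono x (y ∷ ys) with x ≤? y
... | yes _ = x ∷ y ∷ ys
... | no  _ = y ∷ insertMono x ys

monoMul : Mono → Mono → Mono
monoMul m n = foldr insertMono n m

0S : Sym
0S = []

1S : Sym
1S = ([] , ℤ.+ 1) ∷ []

infixl 6 _+S_ _-S_
infixl 7 _*S_

_+S_ : Sym → Sym → Sym
p +S q = p ++ q

scaleS : ℤ → Sym → Sym
scaleS c p = map (λ t → proj₁ t , c ℤ.* proj₂ t) p

-S_ : Sym → Sym
-S p = scaleS (ℤ.- (+ 1)) p

_-S_ : Sym → Sym → Sym
p -S q = p +S (-S q)

_*S_ : Sym → Sym → Sym
p *S q = concatMap (λ s → map (λ t → monoMul (proj₁ s) (proj₁ t) , proj₂ s ℤ.* proj₂ t) q) p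

coeff : Sym → Mono → ℤ
coeff [] ν = +0
coeff ((m , a) ∷ p) ν with ≡-dec ℕ._≟_ m ν
... | yes _ = a ℤ.+ coeff p ν
... | no  _ = coeff p ν

infix 4 _≈S_
_≈S_ : Sym → Sym → Set
p ≈S q = ∀ ν → coeff p ν ≡ coeff q ν

h : ℤ → Sym
h (+ zero)  = 1S
h (+ suc m) = (suc m ∷ [] , + 1) ∷ []
h -[1+ _ ]  = 0S

sumS : List Sym → Sym
sumS = foldr _+S_ 0S

allFinL : (n : ℕ) → List (Fin n)
allFinL zero    = []
allFinL (suc n) = zero ∷ map suc (allFinL n)

sign : ℕ → ℤ
sign zero          = + 1
sign (suc zero)    = ℤ.- (+ 1)
sign (suc (suc k)) = sign k

det : (n : ℕ) → (Fin n → Fin n → Sym) → Sym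
det zero    M = 1S
det (suc n) M =
  sumS (map (λ j → scaleS (sign (toℕ j))
                     (M zero j *S det n (λ a b → M (suc a) (punchIn j b))))
            (allFinL (suc n)))

-- Partitions (weakly decreasing lists of naturals; trailing zeros allowed)

data IsPartition : List ℕ → Set where
  []ᵖ  : IsPartition []
  [_]ᵖ : ∀ a → IsPartition (a ∷ [])
  consᵖ : ∀ {a b l} → a ≥ b → IsPartition (b ∷ l) → IsPartition (a ∷ b ∷ l)

entry : List ℕ → ℕ → ℕ
entry [] _ = 0
entry (x ∷ _) zero = x
entry (_ ∷ xs) (suc k) = entry xs k

skewSchur : List ℕ → List ℕ → Sym
skewSchur λ′ μ =
  det (length λ′) (λ i j →
    h (((+ entry λ′ (toℕ i)) ℤ.- (+ entry μ (toℕ j))) ℤ.- (+ toℕ i) ℤ.+ (+ toℕ j)))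

schur : List ℕ → Sym
schur λ′ = skewSchur λ′ []

SchurPositive : Sym → Set
SchurPositive f =
  Data.Product.Σ (List (List ℕ × ℕ)) λ L →
    Data.List.Relation.Unary.All.All (λ t → IsPartition (proj₁ t)) L
    × (f ≈S sumS (map (λ t → scaleS (+ proj₂ t) (schur (proj₁ t))) L))
  where import Data.List.Relation.Unary.All

-- Symmetric functions are modelled as ℤ-combinations of words in h₁, h₂, …;
-- identifying words up to reordering gives a commutative ring, so identities
-- between Jacobi–Trudi determinants can be checked by a ring solver.
--
-- The Jacobi–Trudi determinants of s_(E+k, B, Z−k), k = 0, …, Z, telescope, so
-- their sum is h_Z s_(E,B) − h_{Z−1} s_(E,B+1).  For i ≥ 3 the difference is a
-- sum of six such closed forms with E ≥ B ≥ Z (a polynomial identity in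
-- h_{i−4}, …, h_{i+6}), hence a sum of Schur functions; the cases i ≤ 2 are
-- computed directly.
module Submission where

open import Defs
open import Data.Nat using (ℕ; suc; _+_)
open import Data.List using (List; []; _∷_)

open import Data.Nat as ℕ using (zero; _≤_; _≤?_; z≤n; s≤s)
import Data.Nat.Properties as ℕP
open import Data.Integer as ℤ using (ℤ; +_; -[1+_])
import Data.Integer.Properties as ℤP
open import Data.Integer.Solver using (module +-*-Solver)
open import Data.Fin using (Fin; toℕ; punchIn; #_) renaming (zero to fzero; suc to fsuc)
open import Data.Product using (_×_; _,_; proj₁; proj₂)
open import Data.Empty using (⊥-elim)
open import Data.Unit using (tt)
open import Data.Maybe using (Maybe; just; nothing)
open import Data.List as List using (_++_; map; length)
import Data.List.Properties as ListP
open import Data.List.Properties using (≡-dec)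
open import Data.List.Relation.Unary.All as All using (All; []; _∷_)
import Data.List.Relation.Unary.All.Properties as AllP
open import Data.List.Relation.Unary.Any using (here; there)
open import Data.List.Relation.Unary.Linked using ([]; [-])
open import Data.List.Relation.Unary.Sorted.TotalOrder ℕP.≤-totalOrder using (Sorted)
import Data.List.Relation.Unary.Sorted.TotalOrder.Properties as SortedP
open import Data.List.Relation.Binary.Equality.Propositional using (≋⇒≡)
open import Data.List.Relation.Binary.Permutation.Propositional
  using (_↭_; ↭-refl; ↭-trans; ↭-reflexive; ↭⇒↭ₛ′; module PermutationReasoning)
import Data.List.Relation.Binary.Permutation.Propositional.Properties as Perm
open import Data.List.Sort.InsertionSort.Base ℕP.≤-decTotalOrder using (insert)
open import Data.List.Sort.InsertionSort.Properties ℕP.≤-decTotalOrder using (insert-↗; insert-cong-↭)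
open import Data.List.Membership.Propositional using (_∈_)
open import Data.List.Membership.Propositional.Properties using (∈-++⁺ˡ; ∈-++⁺ʳ)
open import Data.List.Membership.DecPropositional (≡-dec ℕ._≟_) using (_∈?_)
open import Algebra.Structures using (IsSemigroup)
open import Algebra.Solver.Ring.AlmostCommutativeRing
  using (AlmostCommutativeRing; _-Raw-AlmostCommutative⟶_)
import Algebra.Solver.Ring
open import Relation.Binary.Structures using (IsEquivalence)
open import Relation.Binary.PropositionalEquality
open import Relation.Nullary using (Dec; yes; no; ¬_)
open import Relation.Nullary.Decidable as Dec using (True; toWitness; _×-dec_; dec-true; dec-false)

insertMono≡insert : ∀ x l → insertMono x l ≡ insert x l
insertMono≡insert x [] = refl
insertMono≡insert x (y ∷ l) with x ≤? y
... | yes x≤y rewrite dec-true (x ≤? y) x≤y = refl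
... | no x≰y rewrite dec-false (x ≤? y) x≰y = cong (y ∷_) (insertMono≡insert x l)

↗↭↗⇒≡ : ∀ {xs ys} → Sorted xs → Sorted ys → xs ↭ ys → xs ≡ ys
↗↭↗⇒≡ xs↗ ys↗ xs↭ys =
  ≋⇒≡ (SortedP.↗↭↗⇒≋ ℕP.≤-totalOrder xs↗ ys↗ (↭⇒↭ₛ′ isEquivalence xs↭ys))

monoMul-↗ : ∀ m {n} → Sorted n → Sorted (monoMul m n)
monoMul-↗ [] n↗ = n↗
monoMul-↗ (x ∷ m) {n} n↗ =
  subst Sorted (sym (insertMono≡insert x (monoMul m n))) (insert-↗ x (monoMul-↗ m n↗))

monoMul-↭ : ∀ m n → monoMul m n ↭ m ++ n
monoMul-↭ [] n = ↭-refl
monoMul-↭ (x ∷ m) n =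
  ↭-trans (↭-reflexive (insertMono≡insert x (monoMul m n))) (insert-cong-↭ (monoMul-↭ m n))

sortMono : Mono → Mono
sortMono m = monoMul m []

sortMono-↗ : ∀ m → Sorted (sortMono m)
sortMono-↗ m = monoMul-↗ m []

sortMono-↭ : ∀ m → sortMono m ↭ m
sortMono-↭ m = ↭-trans (monoMul-↭ m []) (Perm.++-identityʳ m)

sortMono-↗-id : ∀ {m} → Sorted m → sortMono m ≡ m
sortMono-↗-id {m} m↗ = ↗↭↗⇒≡ (sortMono-↗ m) m↗ (sortMono-↭ m)

module _ where
  open PermutationReasoning

  monoMul-comm : ∀ {m n} → Sorted m → Sorted n → monoMul m n ≡ monoMul n m
  monoMul-comm {m} {n} m↗ n↗ = ↗↭↗⇒≡ (monoMul-↗ m n↗) (monoMul-↗ n m↗) (begin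
    monoMul m n  ↭⟨ monoMul-↭ m n ⟩
    m ++ n       ↭⟨ Perm.++-comm m n ⟩
    n ++ m       ↭⟨ monoMul-↭ n m ⟨
    monoMul n m  ∎)

  monoMul-assoc : ∀ m n {o} → Sorted o → monoMul (monoMul m n) o ≡ monoMul m (monoMul n o)
  monoMul-assoc m n {o} o↗ =
    ↗↭↗⇒≡ (monoMul-↗ (monoMul m n) o↗) (monoMul-↗ m (monoMul-↗ n o↗)) (begin
      monoMul (monoMul m n) o  ↭⟨ monoMul-↭ (monoMul m n) o ⟩
      monoMul m n ++ o         ↭⟨ Perm.++⁺ʳ o (monoMul-↭ m n) ⟩
      (m ++ n) ++ o            ↭⟨ Perm.++-assoc m n o ⟩
      m ++ (n ++ o)            ↭⟨ Perm.++⁺ˡ m (monoMul-↭ n o) ⟨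
      m ++ monoMul n o         ↭⟨ monoMul-↭ m (monoMul n o) ⟨
      monoMul m (monoMul n o)  ∎)

  sortMono-monoMul : ∀ m n → sortMono (monoMul m n) ≡ monoMul (sortMono m) (sortMono n)
  sortMono-monoMul m n =
    ↗↭↗⇒≡ (sortMono-↗ (monoMul m n)) (monoMul-↗ (sortMono m) (sortMono-↗ n)) (begin
      sortMono (monoMul m n)             ↭⟨ sortMono-↭ (monoMul m n) ⟩
      monoMul m n                        ↭⟨ monoMul-↭ m n ⟩
      m ++ n                             ↭⟨ Perm.++⁺ (sortMono-↭ m) (sortMono-↭ n) ⟨
      sortMono m ++ sortMono n           ↭⟨ monoMul-↭ (sortMono m) (sortMono n) ⟨
      monoMul (sortMono m) (sortMono n)  ∎)

-- Coefficients of products are iterated pairings (coeff-*S), so the ring laws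
-- for _*S_ reduce to laws of pairing.
pairing : Sym → (Mono → ℤ) → ℤ
pairing [] C = + 0
pairing ((m , a) ∷ p) C = a ℤ.* C m ℤ.+ pairing p C

indicator : Mono → Mono → ℤ
indicator ν m with ≡-dec ℕ._≟_ m ν
... | yes _ = + 1
... | no _ = + 0

coeff≡pairing-indicator : ∀ p ν → coeff p ν ≡ pairing p (indicator ν)
coeff≡pairing-indicator [] ν = refl
coeff≡pairing-indicator ((m , a) ∷ p) ν with ≡-dec ℕ._≟_ m ν
... | yes _ = cong₂ ℤ._+_ (sym (ℤP.*-identityʳ a)) (coeff≡pairing-indicator p ν)
... | no _ = begin
  coeff p ν                                ≡⟨ coeff≡pairing-indicator p ν ⟩
  pairing p (indicator ν)                  ≡⟨ ℤP.+-identityˡ _ ⟨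
  + 0 ℤ.+ pairing p (indicator ν)          ≡⟨ cong (ℤ._+ pairing p (indicator ν)) (ℤP.*-zeroʳ a) ⟨
  a ℤ.* + 0 ℤ.+ pairing p (indicator ν)    ∎
  where open ≡-Reasoning

coeff-++ : ∀ p q ν → coeff (p ++ q) ν ≡ coeff p ν ℤ.+ coeff q ν
coeff-++ [] q ν = sym (ℤP.+-identityˡ _)
coeff-++ ((m , a) ∷ p) q ν with ≡-dec ℕ._≟_ m ν
... | yes _ = trans (cong (λ u → a ℤ.+ u) (coeff-++ p q ν)) (sym (ℤP.+-assoc a _ _))
... | no _ = coeff-++ p q ν

pairing-++ : ∀ p q C → pairing (p ++ q) C ≡ pairing p C ℤ.+ pairing q C
pairing-++ [] q C = sym (ℤP.+-identityˡ _)
pairing-++ ((m , a) ∷ p) q C =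
  trans (cong (λ u → a ℤ.* C m ℤ.+ u) (pairing-++ p q C)) (sym (ℤP.+-assoc (a ℤ.* C m) _ _))

pairing-congʳ : ∀ p {C D} → (∀ m → C m ≡ D m) → pairing p C ≡ pairing p D
pairing-congʳ [] C≗D = refl
pairing-congʳ ((m , a) ∷ p) C≗D = cong₂ (λ u v → a ℤ.* u ℤ.+ v) (C≗D m) (pairing-congʳ p C≗D)

pairing-zeroʳ : ∀ p → pairing p (λ _ → + 0) ≡ + 0
pairing-zeroʳ [] = refl
pairing-zeroʳ ((m , a) ∷ p) rewrite pairing-zeroʳ p | ℤP.*-zeroʳ a = refl

pairing-+ʳ : ∀ p C D → pairing p (λ m → C m ℤ.+ D m) ≡ pairing p C ℤ.+ pairing p D
pairing-+ʳ [] C D = refl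
pairing-+ʳ ((m , a) ∷ p) C D rewrite pairing-+ʳ p C D =
  solve 5 (λ a c d x y → a :* (c :+ d) :+ (x :+ y) := (a :* c :+ x) :+ (a :* d :+ y))
    refl a (C m) (D m) (pairing p C) (pairing p D)
  where open +-*-Solver

pairing-*ʳ : ∀ p c C → pairing p (λ m → c ℤ.* C m) ≡ c ℤ.* pairing p C
pairing-*ʳ [] c C = sym (ℤP.*-zeroʳ c)
pairing-*ʳ ((m , a) ∷ p) c C rewrite pairing-*ʳ p c C =
  solve 4 (λ a c x y → a :* (c :* x) :+ c :* y := c :* (a :* x :+ y))
    refl a c (C m) (pairing p C)
  where open +-*-Solver

pairing-comm : ∀ p q (K : Mono → Mono → ℤ) →
  pairing p (λ m → pairing q (K m)) ≡ pairing q (λ n → pairing p (λ m → K m n))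
pairing-comm [] q K = sym (pairing-zeroʳ q)
pairing-comm ((m , a) ∷ p) q K =
  trans (cong₂ ℤ._+_ (sym (pairing-*ʳ q a (K m))) (pairing-comm p q K))
    (sym (pairing-+ʳ q (λ n → a ℤ.* K m n) (λ n → pairing p (λ m → K m n))))

-- One term of p *S q, so that p *S q = concatMap (λ t → t ·ₜ q) p definitionally.
_·ₜ_ : Mono × ℤ → Sym → Sym
(m , a) ·ₜ q = map (λ t → monoMul m (proj₁ t) , a ℤ.* proj₂ t) q

pairing-·ₜ : ∀ m a q C → pairing ((m , a) ·ₜ q) C ≡ a ℤ.* pairing q (λ n → C (monoMul m n))
pairing-·ₜ m a [] C = sym (ℤP.*-zeroʳ a)
pairing-·ₜ m a ((n , b) ∷ q) C rewrite pairing-·ₜ m a q C =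
  solve 4 (λ a b x y → a :* b :* x :+ a :* y := a :* (b :* x :+ y))
    refl a b (C (monoMul m n)) (pairing q (λ n → C (monoMul m n)))
  where open +-*-Solver

pairing-scaleS : ∀ c q C → pairing (scaleS c q) C ≡ c ℤ.* pairing q C
pairing-scaleS c q C = pairing-·ₜ [] c q C

pairing-*S : ∀ p q C → pairing (p *S q) C ≡ pairing p (λ m → pairing q (λ n → C (monoMul m n)))
pairing-*S [] q C = refl
pairing-*S ((m , a) ∷ p) q C =
  trans (pairing-++ ((m , a) ·ₜ q) (p *S q) C)
    (cong₂ ℤ._+_ (pairing-·ₜ m a q C) (pairing-*S p q C))

coeff-scaleS : ∀ c p ν → coeff (scaleS c p) ν ≡ c ℤ.* coeff p ν
coeff-scaleS c p ν = trans (coeff≡pairing-indicator (scaleS c p) ν)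
  (trans (pairing-scaleS c p (indicator ν)) (cong (c ℤ.*_) (sym (coeff≡pairing-indicator p ν))))

coeff-*S : ∀ p q ν → coeff (p *S q) ν ≡ pairing p (λ m → pairing q (λ n → indicator ν (monoMul m n)))
coeff-*S p q ν = trans (coeff≡pairing-indicator (p *S q) ν) (pairing-*S p q (indicator ν))

remove : Mono → Sym → Sym
remove m [] = []
remove m ((n , a) ∷ p) with ≡-dec ℕ._≟_ n m
... | yes _ = remove m p
... | no _ = (n , a) ∷ remove m p

pairing-remove : ∀ m p C → pairing p C ≡ coeff p m ℤ.* C m ℤ.+ pairing (remove m p) C
pairing-remove m [] C = refl
pairing-remove m ((n , a) ∷ p) C with ≡-dec ℕ._≟_ n m
... | yes refl rewrite pairing-remove n p C =
  solve 4 (λ a c x y → a :* c :+ (x :* c :+ y) := (a :+ x) :* c :+ y)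
    refl a (C n) (coeff p n) (pairing (remove n p) C)
  where open +-*-Solver
... | no _ rewrite pairing-remove m p C =
  solve 5 (λ a c x d y → a :* c :+ (x :* d :+ y) := x :* d :+ (a :* c :+ y))
    refl a (C n) (coeff p m) (C m) (pairing (remove m p) C)
  where open +-*-Solver

coeff-remove-self : ∀ m p → coeff (remove m p) m ≡ + 0
coeff-remove-self m [] = refl
coeff-remove-self m ((n , a) ∷ p) with ≡-dec ℕ._≟_ n m
... | yes _ = coeff-remove-self m p
... | no n≢m with ≡-dec ℕ._≟_ n m
...   | yes n≡m = ⊥-elim (n≢m n≡m)
...   | no _ = coeff-remove-self m p

coeff-remove-other : ∀ m p ν → ¬ ν ≡ m → coeff (remove m p) ν ≡ coeff p ν
coeff-remove-other m [] ν ν≢m = refl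
coeff-remove-other m ((n , a) ∷ p) ν ν≢m with ≡-dec ℕ._≟_ n m
... | yes refl with ≡-dec ℕ._≟_ n ν
...   | yes ν≡m = ⊥-elim (ν≢m (sym ν≡m))
...   | no _ = coeff-remove-other m p ν ν≢m
coeff-remove-other m ((n , a) ∷ p) ν ν≢m | no _ with ≡-dec ℕ._≟_ n ν
...   | yes _ = cong (λ u → a ℤ.+ u) (coeff-remove-other m p ν ν≢m)
...   | no _ = coeff-remove-other m p ν ν≢m

length-remove : ∀ m p → length (remove m p) ≤ length p
length-remove m [] = z≤n
length-remove m ((n , a) ∷ p) with ≡-dec ℕ._≟_ n m
... | yes _ = ℕP.m≤n⇒m≤1+n (length-remove m p)
... | no _ = s≤s (length-remove m p)

length-remove-head : ∀ m a p → length (remove m ((m , a) ∷ p)) ≤ length p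
length-remove-head m a p with ≡-dec ℕ._≟_ m m
... | yes _ = length-remove m p
... | no m≢m = ⊥-elim (m≢m refl)

-- Induction on a length bound: removing all terms with the head monomial shortens the sum.
pairing-vanishing : ∀ n r → length r ≤ n → (∀ ν → coeff r ν ≡ + 0) → ∀ C → pairing r C ≡ + 0
pairing-vanishing n [] _ _ C = refl
pairing-vanishing (suc n) ((m , a) ∷ r) (s≤s |r|≤n) r≈0 C = begin
  pairing r′ C                                ≡⟨ pairing-remove m r′ C ⟩
  coeff r′ m ℤ.* C m ℤ.+ pairing rest C       ≡⟨ cong (λ u → u ℤ.* C m ℤ.+ pairing rest C) (r≈0 m) ⟩
  + 0 ℤ.+ pairing rest C                      ≡⟨ ℤP.+-identityˡ _ ⟩
  pairing rest C                              ≡⟨ pairing-vanishing n rest |rest|≤n rest≈0 C ⟩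
  + 0                                         ∎
  where
  open ≡-Reasoning
  r′ = (m , a) ∷ r
  rest = remove m r′
  |rest|≤n : length rest ≤ n
  |rest|≤n = ℕP.≤-trans (length-remove-head m a r) |r|≤n
  rest≈0 : ∀ ν → coeff rest ν ≡ + 0
  rest≈0 ν with ≡-dec ℕ._≟_ ν m
  ... | yes refl = coeff-remove-self ν r′
  ... | no ν≢m = trans (coeff-remove-other m r′ ν ν≢m) (r≈0 ν)

pairing-resp-≈S : ∀ p q → p ≈S q → ∀ C → pairing p C ≡ pairing q C
pairing-resp-≈S p q p≈q C = ℤP.i-j≡0⇒i≡j (pairing p C) (pairing q C) (begin
  pairing p C ℤ.- pairing q C             ≡⟨ cong (λ u → pairing p C ℤ.+ u) (ℤP.-1*i≡-i (pairing q C)) ⟨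
  pairing p C ℤ.+ ℤ.-1ℤ ℤ.* pairing q C   ≡⟨ cong (λ u → pairing p C ℤ.+ u) (pairing-scaleS ℤ.-1ℤ q C) ⟨
  pairing p C ℤ.+ pairing (-S q) C        ≡⟨ pairing-++ p (-S q) C ⟨
  pairing (p -S q) C                      ≡⟨ pairing-vanishing _ (p -S q) ℕP.≤-refl difference≈0 C ⟩
  + 0                                     ∎)
  where
  open ≡-Reasoning
  difference≈0 : ∀ ν → coeff (p -S q) ν ≡ + 0
  difference≈0 ν = begin
    coeff (p -S q) ν                    ≡⟨ coeff-++ p (-S q) ν ⟩
    coeff p ν ℤ.+ coeff (-S q) ν        ≡⟨ cong₂ ℤ._+_ (p≈q ν) (coeff-scaleS ℤ.-1ℤ q ν) ⟩
    coeff q ν ℤ.+ ℤ.-1ℤ ℤ.* coeff q ν   ≡⟨ cong (λ u → coeff q ν ℤ.+ u) (ℤP.-1*i≡-i (coeff q ν)) ⟩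
    coeff q ν ℤ.- coeff q ν             ≡⟨ ℤP.+-inverseʳ (coeff q ν) ⟩
    + 0                                 ∎

≈S-++ : ∀ {p p′ q q′} → p ≈S p′ → q ≈S q′ → p ++ q ≈S p′ ++ q′
≈S-++ {p} {p′} {q} {q′} p≈p′ q≈q′ ν =
  trans (coeff-++ p q ν) (trans (cong₂ ℤ._+_ (p≈p′ ν) (q≈q′ ν)) (sym (coeff-++ p′ q′ ν)))

≈S-scaleS : ∀ c {p p′} → p ≈S p′ → scaleS c p ≈S scaleS c p′
≈S-scaleS c {p} {p′} p≈p′ ν =
  trans (coeff-scaleS c p ν) (trans (cong (c ℤ.*_) (p≈p′ ν)) (sym (coeff-scaleS c p′ ν)))

≈S-*S : ∀ {p p′ q q′} → p ≈S p′ → q ≈S q′ → p *S q ≈S p′ *S q′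
≈S-*S {p} {p′} {q} {q′} p≈p′ q≈q′ ν = begin
  coeff (p *S q) ν                                              ≡⟨ coeff-*S p q ν ⟩
  pairing p (λ m → pairing q (λ n → indicator ν (monoMul m n)))   ≡⟨ pairing-congʳ p (λ m → pairing-resp-≈S q q′ q≈q′ _) ⟩
  pairing p (λ m → pairing q′ (λ n → indicator ν (monoMul m n)))  ≡⟨ pairing-resp-≈S p p′ p≈p′ _ ⟩
  pairing p′ (λ m → pairing q′ (λ n → indicator ν (monoMul m n))) ≡⟨ coeff-*S p′ q′ ν ⟨
  coeff (p′ *S q′) ν                                            ∎
  where open ≡-Reasoning

AllSorted : Sym → Set
AllSorted = All (λ t → Sorted (proj₁ t))

pairing-congʳ-↗ : ∀ p {C D} → AllSorted p → (∀ m → Sorted m → C m ≡ D m) → pairing p C ≡ pairing p D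
pairing-congʳ-↗ [] [] C≗D = refl
pairing-congʳ-↗ ((m , a) ∷ p) (m↗ ∷ p↗) C≗D =
  cong₂ (λ u v → a ℤ.* u ℤ.+ v) (C≗D m m↗) (pairing-congʳ-↗ p p↗ C≗D)

norm : Sym → Sym
norm = map (λ t → sortMono (proj₁ t) , proj₂ t)

-- _≈S_ compares monomials as lists, so it tells h₂h₁ from h₁h₂ and is not a
-- commutative ring equality; comparing sorted representatives repairs this.
infix 4 _≋_
record _≋_ (p q : Sym) : Set where
  constructor ≋-intro
  field ≋⇒norm-≈S : norm p ≈S norm q

norm-↗ : ∀ p → AllSorted (norm p)
norm-↗ [] = []
norm-↗ ((m , a) ∷ p) = sortMono-↗ m ∷ norm-↗ p

norm-id : ∀ {p} → AllSorted p → norm p ≡ p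
norm-id [] = refl
norm-id {(m , a) ∷ p} (m↗ ∷ p↗) = cong₂ _∷_ (cong (_, a) (sortMono-↗-id m↗)) (norm-id p↗)

norm-++ : ∀ p q → norm (p ++ q) ≡ norm p ++ norm q
norm-++ p q = ListP.map-++ _ p q

norm-scaleS : ∀ c p → norm (scaleS c p) ≡ scaleS c (norm p)
norm-scaleS c p = trans (sym (ListP.map-∘ p)) (ListP.map-∘ p)

norm-·ₜ : ∀ m a q → norm ((m , a) ·ₜ q) ≡ (sortMono m , a) ·ₜ norm q
norm-·ₜ m a [] = refl
norm-·ₜ m a ((n , b) ∷ q) = cong₂ _∷_ (cong (_, a ℤ.* b) (sortMono-monoMul m n)) (norm-·ₜ m a q)

norm-*S : ∀ p q → norm (p *S q) ≡ norm p *S norm q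
norm-*S [] q = refl
norm-*S ((m , a) ∷ p) q =
  trans (norm-++ ((m , a) ·ₜ q) (p *S q)) (cong₂ _++_ (norm-·ₜ m a q) (norm-*S p q))

≋-via-norm : ∀ {p q p′ q′} → p′ ≡ norm p → q′ ≡ norm q → p′ ≈S q′ → p ≋ q
≋-via-norm refl refl p′≈q′ = ≋-intro p′≈q′

≋-reflexive : ∀ {p q} → p ≡ q → p ≋ q
≋-reflexive refl = ≋-intro (λ ν → refl)

≋-refl : ∀ {p} → p ≋ p
≋-refl = ≋-reflexive refl

≋-sym : ∀ {p q} → p ≋ q → q ≋ p
≋-sym (≋-intro p≈q) = ≋-intro (λ ν → sym (p≈q ν))

≋-trans : ∀ {p q r} → p ≋ q → q ≋ r → p ≋ r
≋-trans (≋-intro p≈q) (≋-intro q≈r) = ≋-intro (λ ν → trans (p≈q ν) (q≈r ν))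

≋⇒≈S : ∀ {p q} → AllSorted p → AllSorted q → p ≋ q → p ≈S q
≋⇒≈S p↗ q↗ (≋-intro p≈q) ν =
  trans (cong (λ r → coeff r ν) (sym (norm-id p↗))) (trans (p≈q ν) (cong (λ r → coeff r ν) (norm-id q↗)))

≈S⇒≋ : ∀ {p q} → AllSorted p → AllSorted q → p ≈S q → p ≋ q
≈S⇒≋ p↗ q↗ p≈q = ≋-via-norm (sym (norm-id p↗)) (sym (norm-id q↗)) p≈q

scaleS-↗ : ∀ c {p} → AllSorted p → AllSorted (scaleS c p)
scaleS-↗ c [] = []
scaleS-↗ c (m↗ ∷ p↗) = m↗ ∷ scaleS-↗ c p↗

*S-↗ : ∀ p {q} → AllSorted q → AllSorted (p *S q)
*S-↗ [] q↗ = []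
*S-↗ ((m , a) ∷ p) q↗ = AllP.++⁺ (·ₜ-↗ q↗) (*S-↗ p q↗)
  where
  ·ₜ-↗ : ∀ {q} → AllSorted q → AllSorted ((m , a) ·ₜ q)
  ·ₜ-↗ [] = []
  ·ₜ-↗ (n↗ ∷ q↗) = monoMul-↗ m n↗ ∷ ·ₜ-↗ q↗

+S-cong : ∀ {p p′ q q′} → p ≋ p′ → q ≋ q′ → p +S q ≋ p′ +S q′
+S-cong {p} {p′} {q} {q′} (≋-intro p≈p′) (≋-intro q≈q′) =
  ≋-via-norm (sym (norm-++ p q)) (sym (norm-++ p′ q′)) (≈S-++ {norm p} {norm p′} {norm q} {norm q′} p≈p′ q≈q′)

*S-cong : ∀ {p p′ q q′} → p ≋ p′ → q ≋ q′ → p *S q ≋ p′ *S q′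
*S-cong {p} {p′} {q} {q′} (≋-intro p≈p′) (≋-intro q≈q′) =
  ≋-via-norm (sym (norm-*S p q)) (sym (norm-*S p′ q′)) (≈S-*S {norm p} {norm p′} {norm q} {norm q′} p≈p′ q≈q′)

scaleS-cong : ∀ c {p p′} → p ≋ p′ → scaleS c p ≋ scaleS c p′
scaleS-cong c {p} {p′} (≋-intro p≈p′) =
  ≋-via-norm (sym (norm-scaleS c p)) (sym (norm-scaleS c p′)) (≈S-scaleS c {norm p} {norm p′} p≈p′)

-S-cong : ∀ {p p′} → p ≋ p′ → -S p ≋ -S p′
-S-cong = scaleS-cong ℤ.-1ℤ

+S-comm : ∀ p q → p +S q ≋ q +S p
+S-comm p q = ≋-via-norm (sym (norm-++ p q)) (sym (norm-++ q p)) λ ν →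
  trans (coeff-++ (norm p) (norm q) ν)
    (trans (ℤP.+-comm (coeff (norm p) ν) _) (sym (coeff-++ (norm q) (norm p) ν)))

*S-assoc-↗ : ∀ p q r → AllSorted r → (p *S q) *S r ≈S p *S (q *S r)
*S-assoc-↗ p q r r↗ ν = begin
  coeff ((p *S q) *S r) ν
    ≡⟨ coeff-*S (p *S q) r ν ⟩
  pairing (p *S q) (λ w → pairing r (λ o → indicator ν (monoMul w o)))
    ≡⟨ pairing-*S p q _ ⟩
  pairing p (λ m → pairing q (λ n → pairing r (λ o → indicator ν (monoMul (monoMul m n) o))))
    ≡⟨ pairing-congʳ p (λ m → pairing-congʳ q (λ n → pairing-congʳ-↗ r r↗ (λ o o↗ →
         cong (indicator ν) (monoMul-assoc m n o↗)))) ⟩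
  pairing p (λ m → pairing q (λ n → pairing r (λ o → indicator ν (monoMul m (monoMul n o)))))
    ≡⟨ pairing-congʳ p (λ m → pairing-*S q r (λ w → indicator ν (monoMul m w))) ⟨
  pairing p (λ m → pairing (q *S r) (λ w → indicator ν (monoMul m w)))
    ≡⟨ coeff-*S p (q *S r) ν ⟨
  coeff (p *S (q *S r)) ν
    ∎
  where open ≡-Reasoning

*S-comm-↗ : ∀ p q → AllSorted p → AllSorted q → p *S q ≈S q *S p
*S-comm-↗ p q p↗ q↗ ν = begin
  coeff (p *S q) ν                                              ≡⟨ coeff-*S p q ν ⟩
  pairing p (λ m → pairing q (λ n → indicator ν (monoMul m n)))   ≡⟨ pairing-comm p q _ ⟩
  pairing q (λ n → pairing p (λ m → indicator ν (monoMul m n)))   ≡⟨ pairing-congʳ-↗ q q↗ (λ n n↗ →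
                                                                      pairing-congʳ-↗ p p↗ (λ m m↗ →
                                                                        cong (indicator ν) (monoMul-comm m↗ n↗))) ⟩
  pairing q (λ n → pairing p (λ m → indicator ν (monoMul n m)))   ≡⟨ coeff-*S q p ν ⟨
  coeff (q *S p) ν                                              ∎
  where open ≡-Reasoning

*S-assoc : ∀ p q r → (p *S q) *S r ≋ p *S (q *S r)
*S-assoc p q r =
  ≋-via-norm (trans (cong (_*S norm r) (sym (norm-*S p q))) (sym (norm-*S (p *S q) r)))
             (trans (cong (norm p *S_) (sym (norm-*S q r))) (sym (norm-*S p (q *S r))))
             (*S-assoc-↗ (norm p) (norm q) (norm r) (norm-↗ r))

*S-comm : ∀ p q → p *S q ≋ q *S p
*S-comm p q = ≋-via-norm (sym (norm-*S p q)) (sym (norm-*S q p))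
  (*S-comm-↗ (norm p) (norm q) (norm-↗ p) (norm-↗ q))

*S-identityˡ : ∀ p → 1S *S p ≋ p
*S-identityˡ p = ≋-via-norm (sym (norm-*S 1S p)) refl λ ν →
  trans (coeff-*S 1S (norm p) ν)
    (trans (ℤP.+-identityʳ _) (trans (ℤP.*-identityˡ _) (sym (coeff≡pairing-indicator (norm p) ν))))

-S‿*S-distribˡ : ∀ p q → (-S p) *S q ≋ -S (p *S q)
-S‿*S-distribˡ p q =
  ≋-via-norm (trans (cong (_*S norm q) (sym (norm-scaleS ℤ.-1ℤ p))) (sym (norm-*S (-S p) q)))
             (trans (cong -S_ (sym (norm-*S p q))) (sym (norm-scaleS ℤ.-1ℤ (p *S q))))
             λ ν → begin
    coeff (-S norm p *S norm q) ν
      ≡⟨ coeff-*S (-S norm p) (norm q) ν ⟩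
    pairing (-S norm p) (λ m → pairing (norm q) (λ n → indicator ν (monoMul m n)))
      ≡⟨ pairing-scaleS ℤ.-1ℤ (norm p) _ ⟩
    ℤ.-1ℤ ℤ.* pairing (norm p) (λ m → pairing (norm q) (λ n → indicator ν (monoMul m n)))
      ≡⟨ cong (ℤ.-1ℤ ℤ.*_) (coeff-*S (norm p) (norm q) ν) ⟨
    ℤ.-1ℤ ℤ.* coeff (norm p *S norm q) ν
      ≡⟨ coeff-scaleS ℤ.-1ℤ (norm p *S norm q) ν ⟨
    coeff (-S (norm p *S norm q)) ν
      ∎
  where open ≡-Reasoning

-S‿+S-comm : ∀ p q → (-S p) +S (-S q) ≋ -S (p +S q)
-S‿+S-comm p q = ≋-reflexive (sym (ListP.map-++ _ p q))

-- The constant 0 is the empty sum, so that the solver's constant 0 is 0S itself.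
constS : ℤ → Sym
constS (+ zero) = []
constS c@(+ suc _) = ([] , c) ∷ []
constS c@(-[1+ _ ]) = ([] , c) ∷ []

coeff-constant : ∀ c ν → coeff (([] , c) ∷ []) ν ≡ c ℤ.* indicator ν []
coeff-constant c ν with ≡-dec ℕ._≟_ [] ν
... | yes _ = trans (ℤP.+-identityʳ c) (sym (ℤP.*-identityʳ c))
... | no _ = sym (ℤP.*-zeroʳ c)

coeff-constS : ∀ c ν → coeff (constS c) ν ≡ c ℤ.* indicator ν []
coeff-constS (+ zero) ν = refl
coeff-constS c@(+ suc _) ν = coeff-constant c ν
coeff-constS c@(-[1+ _ ]) ν = coeff-constant c ν

constS-↗ : ∀ c → AllSorted (constS c)
constS-↗ (+ zero) = []
constS-↗ (+ suc _) = [] ∷ []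
constS-↗ (-[1+ _ ]) = [] ∷ []

constS-≋ : ∀ {c p} → AllSorted p → (∀ ν → c ℤ.* indicator ν [] ≡ coeff p ν) → constS c ≋ p
constS-≋ {c} p↗ e = ≈S⇒≋ (constS-↗ c) p↗ (λ ν → trans (coeff-constS c ν) (e ν))

constS-+ : ∀ c d → constS (c ℤ.+ d) ≋ constS c +S constS d
constS-+ c d = constS-≋ (AllP.++⁺ (constS-↗ c) (constS-↗ d)) λ ν → begin
  (c ℤ.+ d) ℤ.* indicator ν []                                  ≡⟨ ℤP.*-distribʳ-+ (indicator ν []) c d ⟩
  c ℤ.* indicator ν [] ℤ.+ d ℤ.* indicator ν []                 ≡⟨ cong₂ ℤ._+_ (coeff-constS c ν) (coeff-constS d ν) ⟨
  coeff (constS c) ν ℤ.+ coeff (constS d) ν                     ≡⟨ coeff-++ (constS c) (constS d) ν ⟨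
  coeff (constS c +S constS d) ν                                ∎
  where open ≡-Reasoning

pairing-constS : ∀ c C → pairing (constS c) C ≡ c ℤ.* C []
pairing-constS (+ zero) C = sym (ℤP.*-zeroˡ (C []))
pairing-constS (+ suc _) C = ℤP.+-identityʳ _
pairing-constS (-[1+ _ ]) C = ℤP.+-identityʳ _

constS-* : ∀ c d → constS (c ℤ.* d) ≋ constS c *S constS d
constS-* c d = constS-≋ (*S-↗ (constS c) (constS-↗ d)) λ ν → begin
  c ℤ.* d ℤ.* indicator ν []                 ≡⟨ ℤP.*-assoc c d (indicator ν []) ⟩
  c ℤ.* (d ℤ.* indicator ν [])               ≡⟨ cong (c ℤ.*_) (pairing-constS d (indicator ν)) ⟨
  c ℤ.* pairing (constS d) (indicator ν)     ≡⟨ pairing-constS c _ ⟨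
  pairing (constS c) (λ m → pairing (constS d) (λ n → indicator ν (monoMul m n)))  ≡⟨ coeff-*S (constS c) (constS d) ν ⟨
  coeff (constS c *S constS d) ν             ∎
  where open ≡-Reasoning

constS-neg : ∀ c → constS (ℤ.- c) ≋ -S constS c
constS-neg c = constS-≋ (scaleS-↗ ℤ.-1ℤ (constS-↗ c)) λ ν → begin
  ℤ.- c ℤ.* indicator ν []                    ≡⟨ ℤP.neg-distribˡ-* c (indicator ν []) ⟨
  ℤ.- (c ℤ.* indicator ν [])                  ≡⟨ ℤP.-1*i≡-i _ ⟨
  ℤ.-1ℤ ℤ.* (c ℤ.* indicator ν [])            ≡⟨ cong (ℤ.-1ℤ ℤ.*_) (coeff-constS c ν) ⟨
  ℤ.-1ℤ ℤ.* coeff (constS c) ν                ≡⟨ coeff-scaleS ℤ.-1ℤ (constS c) ν ⟨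
  coeff (-S constS c) ν                       ∎
  where open ≡-Reasoning

≋-isEquivalence : IsEquivalence _≋_
≋-isEquivalence = record { refl = ≋-refl ; sym = ≋-sym ; trans = ≋-trans }

open import Algebra.Structures.Biased _≋_
  using (isCommutativeMonoidˡ; isCommutativeSemiringˡ)

+S-isSemigroup : IsSemigroup _≋_ _+S_
+S-isSemigroup = record
  { isMagma = record { isEquivalence = ≋-isEquivalence ; ∙-cong = +S-cong }
  ; assoc = λ p q r → ≋-reflexive (ListP.++-assoc p q r) }

*S-isSemigroup : IsSemigroup _≋_ _*S_
*S-isSemigroup = record
  { isMagma = record { isEquivalence = ≋-isEquivalence ; ∙-cong = *S-cong }
  ; assoc = *S-assoc }

Sym-ring : AlmostCommutativeRing _ _
Sym-ring = record
  { Carrier = Sym ; _≈_ = _≋_ ; _+_ = _+S_ ; _*_ = _*S_ ; -_ = -S_ ; 0# = 0S ; 1# = 1S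
  ; isAlmostCommutativeRing = record
    { isCommutativeSemiring = isCommutativeSemiringˡ (record
        { +-isCommutativeMonoid = isCommutativeMonoidˡ (record
            { isSemigroup = +S-isSemigroup ; identityˡ = λ p → ≋-refl ; comm = +S-comm })
        ; *-isCommutativeMonoid = isCommutativeMonoidˡ (record
            { isSemigroup = *S-isSemigroup ; identityˡ = *S-identityˡ ; comm = *S-comm })
        ; distribʳ = λ p q r → ≋-reflexive (ListP.concatMap-++ _ q r)
        ; zeroˡ = λ p → ≋-refl })
    ; -‿cong = -S-cong
    ; -‿*-distribˡ = -S‿*S-distribˡ
    ; -‿+-comm = -S‿+S-comm } }

constS-morphism : ℤ.+-*-rawRing -Raw-AlmostCommutative⟶ Sym-ring
constS-morphism = record
  { ⟦_⟧ = constS ; +-homo = constS-+ ; *-homo = constS-* ; -‿homo = constS-neg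
  ; 0-homo = ≋-refl ; 1-homo = ≋-refl }

constS-≟ : ∀ c d → Maybe (constS c ≋ constS d)
constS-≟ c d with c ℤ.≟ d
... | yes refl = just ≋-refl
... | no _ = nothing

module SymSolver = Algebra.Solver.Ring ℤ.+-*-rawRing Sym-ring constS-morphism constS-≟

scaleS-identity : ∀ p → scaleS (+ 1) p ≋ p
scaleS-identity p = ≋-via-norm (sym (norm-scaleS (+ 1) p)) refl λ ν →
  trans (coeff-scaleS (+ 1) (norm p) ν) (ℤP.*-identityˡ _)

+S-identityʳ : ∀ p → p +S 0S ≋ p
+S-identityʳ p = ≋-reflexive (ListP.++-identityʳ p)

module JacobiTrudiShapes {A : Set} (_⊕_ _⊗_ : A → A → A) (⊝_ : A → A) where
  det₂ : A → A → A → A → A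
  det₂ a b c d = (a ⊗ d) ⊕ (⊝ (b ⊗ c))

  -- Laplace expansion along the first row, associated as det unfolds.
  det₃ : A → A → A → A → A → A → A → A → A → A
  det₃ a b c d e f g h′ i = (a ⊗ det₂ e f h′ i) ⊕ ((⊝ (b ⊗ det₂ d f g i)) ⊕ (c ⊗ det₂ d e g h′))

  det₂-cong : ∀ {a b c d a′ b′ c′ d′} → a ≡ a′ → b ≡ b′ → c ≡ c′ → d ≡ d′ →
              det₂ a b c d ≡ det₂ a′ b′ c′ d′
  det₂-cong refl refl refl refl = refl

  det₃-cong : ∀ {a b c d e f g h′ i a′ b′ c′ d′ e′ f′ g′ h″ i′} →
              a ≡ a′ → b ≡ b′ → c ≡ c′ → d ≡ d′ → e ≡ e′ → f ≡ f′ → g ≡ g′ → h′ ≡ h″ → i ≡ i′ →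
              det₃ a b c d e f g h′ i ≡ det₃ a′ b′ c′ d′ e′ f′ g′ h″ i′
  det₃-cong refl refl refl refl refl refl refl refl refl = refl

  -- With e_k = h_{E+k}, b_k = h_{B+k}, z_k = h_{Z+k} this is h_Z s_(E,B) − h_{Z−1} s_(E,B+1).
  slideSumShape : (e₀ e₁ b₋₁ b₀ b₁ z₀ z₋₁ : A) → A
  slideSumShape e₀ e₁ b₋₁ b₀ b₁ z₀ z₋₁ = (z₀ ⊗ det₂ e₀ e₁ b₋₁ b₀) ⊕ (⊝ (z₋₁ ⊗ det₂ e₀ e₁ b₀ b₁))

open JacobiTrudiShapes _+S_ _*S_ -S_
module Poly {n} = JacobiTrudiShapes (SymSolver._:+_ {n}) SymSolver._:*_ SymSolver.:-_

det-1 : ∀ M → det 1 M ≋ M (# 0) (# 0)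
det-1 M = ≋-trans (+S-identityʳ _) (≋-trans (scaleS-identity _) (≋-trans (*S-comm _ 1S) (*S-identityˡ _)))

det-2 : ∀ M → det 2 M ≋
  det₂ (M (# 0) (# 0)) (M (# 0) (# 1)) (M (# 1) (# 0)) (M (# 1) (# 1))
det-2 M =
  +S-cong (≋-trans (scaleS-identity _) (*S-cong (≋-refl {M (# 0) (# 0)}) (det-1 (minor (# 0)))))
          (≋-trans (+S-identityʳ _) (-S-cong (*S-cong (≋-refl {M (# 0) (# 1)}) (det-1 (minor (# 1))))))
  where
  minor : Fin 2 → Fin 1 → Fin 1 → Sym
  minor j a b = M (fsuc a) (punchIn j b)

det-3 : ∀ M → det 3 M ≋
  det₃ (M (# 0) (# 0)) (M (# 0) (# 1)) (M (# 0) (# 2))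
       (M (# 1) (# 0)) (M (# 1) (# 1)) (M (# 1) (# 2))
       (M (# 2) (# 0)) (M (# 2) (# 1)) (M (# 2) (# 2))
det-3 M =
  +S-cong (≋-trans (scaleS-identity _) (cofactor (# 0)))
    (+S-cong (-S-cong (cofactor (# 1)))
             (≋-trans (+S-identityʳ _) (≋-trans (scaleS-identity _) (cofactor (# 2)))))
  where
  minor : Fin 3 → Fin 2 → Fin 2 → Sym
  minor j a b = M (fsuc a) (punchIn j b)
  cofactor : ∀ j → M (# 0) j *S det 2 (minor j) ≋
    M (# 0) j *S det₂ (minor j (# 0) (# 0)) (minor j (# 0) (# 1)) (minor j (# 1) (# 0)) (minor j (# 1) (# 1))
  cofactor j = *S-cong (≋-refl {M (# 0) j}) (det-2 (minor j))

-- h_{j+k}, written k + j so that hAt (c + j) k and hAt j (k + c) agree definitionally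
-- for numerals c and k.
hAt : ℕ → ℤ → Sym
hAt j k = h (k ℤ.+ + j)

h-entry : ∀ {x} j c y a b → x ≡ c + j →
  h (((+ x ℤ.- + y) ℤ.- + a) ℤ.+ + b) ≡ hAt j (((+ c ℤ.- + y) ℤ.- + a) ℤ.+ + b)
h-entry j c y a b refl = cong h (trans (cong (λ u → ((u ℤ.- + y) ℤ.- + a) ℤ.+ + b) (ℤP.pos-+ c j))
  (solve 5 (λ c j y a b → ((c :+ j) :- y) :- a :+ b := (((c :- y) :- a) :+ b) :+ j)
     refl (+ c) (+ j) (+ y) (+ a) (+ b)))
  where open +-*-Solver

jacobiTrudi : (n : ℕ) → List ℕ → List ℕ → Fin n → Fin n → Sym
jacobiTrudi n λ′ μ i j = h (((+ entry λ′ (toℕ i)) ℤ.- (+ entry μ (toℕ j))) ℤ.- (+ toℕ i) ℤ.+ (+ toℕ j))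

schur-3rows : ∀ E B Z → schur (E ∷ B ∷ suc Z ∷ []) ≋
  det₃ (hAt E (+ 0)) (hAt E (+ 1)) (hAt E (+ 2)) (hAt B ℤ.-1ℤ) (hAt B (+ 0)) (hAt B (+ 1))
       (hAt Z ℤ.-1ℤ) (hAt Z (+ 0)) (hAt Z (+ 1))
schur-3rows E B Z = ≋-trans (det-3 (jacobiTrudi 3 (E ∷ B ∷ suc Z ∷ []) [])) (≋-reflexive (det₃-cong
  (h-entry E 0 0 0 0 refl) (h-entry E 0 0 0 1 refl) (h-entry E 0 0 0 2 refl)
  (h-entry B 0 0 1 0 refl) (h-entry B 0 0 1 1 refl) (h-entry B 0 0 1 2 refl)
  (h-entry Z 1 0 2 0 refl) (h-entry Z 1 0 2 1 refl) (h-entry Z 1 0 2 2 refl)))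

schur-3rows-trailing0 : ∀ E B → schur (E ∷ B ∷ 0 ∷ []) ≋
  det₃ (hAt E (+ 0)) (hAt E (+ 1)) (hAt E (+ 2)) (hAt B ℤ.-1ℤ) (hAt B (+ 0)) (hAt B (+ 1)) 0S 0S 1S
schur-3rows-trailing0 E B = ≋-trans (det-3 (jacobiTrudi 3 (E ∷ B ∷ 0 ∷ []) [])) (≋-reflexive (det₃-cong
  (h-entry E 0 0 0 0 refl) (h-entry E 0 0 0 1 refl) (h-entry E 0 0 0 2 refl)
  (h-entry B 0 0 1 0 refl) (h-entry B 0 0 1 1 refl) (h-entry B 0 0 1 2 refl)
  refl refl refl))

schurCombination : List (List ℕ × ℕ) → Sym
schurCombination L = sumS (map (λ t → scaleS (+ proj₂ t) (schur (proj₁ t))) L)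

schurCombination-++ : ∀ L M → schurCombination (L ++ M) ≋ schurCombination L +S schurCombination M
schurCombination-++ L M = ≋-reflexive
  (trans (cong List.concat (ListP.map-++ _ L M)) (sym (ListP.concat-++ (map _ L) (map _ M))))

slideFamily : ℕ → ℕ → ℕ → List (List ℕ × ℕ)
slideFamily E B zero = ((E ∷ B ∷ 0 ∷ []) , 1) ∷ []
slideFamily E B (suc Z) = ((E ∷ B ∷ suc Z ∷ []) , 1) ∷ slideFamily (suc E) B Z

slideSum : ℕ → ℕ → ℕ → Sym
slideSum E B Z = slideSumShape (hAt E (+ 0)) (hAt E (+ 1)) (hAt B ℤ.-1ℤ) (hAt B (+ 0)) (hAt B (+ 1))
                               (hAt Z (+ 0)) (hAt Z ℤ.-1ℤ)

schurCombination-slideFamily : ∀ E B Z → schurCombination (slideFamily E B Z) ≋ slideSum E B Z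
schurCombination-slideFamily E B zero =
  ≋-trans (+S-identityʳ _) (≋-trans (scaleS-identity _) (≋-trans (schur-3rows-trailing0 E B)
    (expand-last-row (hAt E (+ 0)) (hAt E (+ 1)) (hAt E (+ 2)) (hAt B ℤ.-1ℤ) (hAt B (+ 0)) (hAt B (+ 1)))))
  where
  open SymSolver
  expand-last-row : ∀ e₀ e₁ e₂ b₋₁ b₀ b₁ →
    det₃ e₀ e₁ e₂ b₋₁ b₀ b₁ 0S 0S 1S ≋ slideSumShape e₀ e₁ b₋₁ b₀ b₁ 1S 0S
  expand-last-row = solve 6 (λ e₀ e₁ e₂ b₋₁ b₀ b₁ →
    Poly.det₃ e₀ e₁ e₂ b₋₁ b₀ b₁ (con (+ 0)) (con (+ 0)) (con (+ 1))
      := Poly.slideSumShape e₀ e₁ b₋₁ b₀ b₁ (con (+ 1)) (con (+ 0))) ≋-refl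
schurCombination-slideFamily E B (suc Z) =
  ≋-trans (+S-cong (≋-trans (scaleS-identity _) (schur-3rows E B Z)) (schurCombination-slideFamily (suc E) B Z))
    (telescope (hAt E (+ 0)) (hAt E (+ 1)) (hAt E (+ 2)) (hAt B ℤ.-1ℤ) (hAt B (+ 0)) (hAt B (+ 1))
               (hAt Z ℤ.-1ℤ) (hAt Z (+ 0)) (hAt Z (+ 1)))
  where
  open SymSolver
  telescope : ∀ e₀ e₁ e₂ b₋₁ b₀ b₁ z₋₁ z₀ z₁ →
    det₃ e₀ e₁ e₂ b₋₁ b₀ b₁ z₋₁ z₀ z₁ +S slideSumShape e₁ e₂ b₋₁ b₀ b₁ z₀ z₋₁
      ≋ slideSumShape e₀ e₁ b₋₁ b₀ b₁ z₁ z₀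
  telescope = solve 9 (λ e₀ e₁ e₂ b₋₁ b₀ b₁ z₋₁ z₀ z₁ →
    Poly.det₃ e₀ e₁ e₂ b₋₁ b₀ b₁ z₋₁ z₀ z₁ :+ Poly.slideSumShape e₁ e₂ b₋₁ b₀ b₁ z₀ z₋₁
      := Poly.slideSumShape e₀ e₁ b₋₁ b₀ b₁ z₁ z₀) ≋-refl

schurDifference : ℕ → Sym
schurDifference i = skewSchur (i + 3 ∷ i ∷ []) (1 ∷ []) *S schur (suc i ∷ [])
                    -S schur (i + 2 ∷ suc i ∷ []) *S schur (i ∷ [])

schurDifference-jacobiTrudi : ∀ j → let a = λ k → hAt j (+ k) in
  schurDifference (3 + j) ≋ det₂ (a 5) (a 7) (a 1) (a 3) *S a 4 -S det₂ (a 5) (a 6) (a 3) (a 4) *S a 3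
schurDifference-jacobiTrudi j =
  +S-cong (*S-cong (≋-trans (det-2 (jacobiTrudi 2 (i + 3 ∷ i ∷ []) (1 ∷ [])))
                            (≋-reflexive (det₂-cong (h-entry j 6 1 0 0 i+3≡6+j) (h-entry j 6 0 0 1 i+3≡6+j)
                                                    (h-entry j 3 1 1 0 refl) (h-entry j 3 0 1 1 refl))))
                   (≋-trans (det-1 (jacobiTrudi 1 (suc i ∷ []) [])) (≋-reflexive (h-entry j 4 0 0 0 refl))))
          (-S-cong (*S-cong (≋-trans (det-2 (jacobiTrudi 2 (i + 2 ∷ suc i ∷ []) []))
                                     (≋-reflexive (det₂-cong (h-entry j 5 0 0 0 i+2≡5+j) (h-entry j 5 0 0 1 i+2≡5+j)
                                                             (h-entry j 4 0 1 0 refl) (h-entry j 4 0 1 1 refl))))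
                            (≋-trans (det-1 (jacobiTrudi 1 (i ∷ []) [])) (≋-reflexive (h-entry j 3 0 0 0 refl)))))
  where
  i = 3 + j
  i+3≡6+j : i + 3 ≡ 6 + j
  i+3≡6+j = ℕP.+-comm i 3
  i+2≡5+j : i + 2 ≡ 5 + j
  i+2≡5+j = ℕP.+-comm i 2

-- Relative to i = 3 + j the families start at (i+3,i,i), (i+5,i−1,i−1),
-- (i+4,i,i−1), (i+3,i+1,i−1), (i+3,i+2,i−2) and (i+3,i+3,i−3).
sixFamilies : ℕ → List (List ℕ × ℕ)
sixFamilies j = slideFamily (6 + j) (3 + j) (3 + j) ++ slideFamily (8 + j) (2 + j) (2 + j)
             ++ slideFamily (7 + j) (3 + j) (2 + j) ++ slideFamily (6 + j) (4 + j) (2 + j)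
             ++ slideFamily (6 + j) (5 + j) (1 + j) ++ slideFamily (6 + j) (6 + j) j

schurCombination-sixFamilies : ∀ j → schurCombination (sixFamilies j) ≋
  slideSum (6 + j) (3 + j) (3 + j) +S (slideSum (8 + j) (2 + j) (2 + j)
  +S (slideSum (7 + j) (3 + j) (2 + j) +S (slideSum (6 + j) (4 + j) (2 + j)
  +S (slideSum (6 + j) (5 + j) (1 + j) +S slideSum (6 + j) (6 + j) j))))
schurCombination-sixFamilies j =
  family (slideFamily (6 + j) (3 + j) (3 + j)) (schurCombination-slideFamily (6 + j) (3 + j) (3 + j))
  (family (slideFamily (8 + j) (2 + j) (2 + j)) (schurCombination-slideFamily (8 + j) (2 + j) (2 + j))
  (family (slideFamily (7 + j) (3 + j) (2 + j)) (schurCombination-slideFamily (7 + j) (3 + j) (2 + j))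
  (family (slideFamily (6 + j) (4 + j) (2 + j)) (schurCombination-slideFamily (6 + j) (4 + j) (2 + j))
  (family (slideFamily (6 + j) (5 + j) (1 + j)) (schurCombination-slideFamily (6 + j) (5 + j) (1 + j))
          (schurCombination-slideFamily (6 + j) (6 + j) j)))))
  where
  family : ∀ L {M s t} → schurCombination L ≋ s → schurCombination M ≋ t → schurCombination (L ++ M) ≋ s +S t
  family L {M} L≋s M≋t = ≋-trans (schurCombination-++ L M) (+S-cong L≋s M≋t)

schurDifference≋sixFamilies : ∀ j → schurDifference (3 + j) ≋ schurCombination (sixFamilies j)
schurDifference≋sixFamilies j = ≋-trans (schurDifference-jacobiTrudi j) (≋-trans
  (identity (hAt j ℤ.-1ℤ) (a 0) (a 1) (a 2) (a 3) (a 4) (a 5) (a 6) (a 7) (a 8) (a 9))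
  (≋-sym (schurCombination-sixFamilies j)))
  where
  a = λ k → hAt j (+ k)
  open SymSolver
  identity : ∀ a₋₁ a₀ a₁ a₂ a₃ a₄ a₅ a₆ a₇ a₈ a₉ →
    det₂ a₅ a₇ a₁ a₃ *S a₄ -S det₂ a₅ a₆ a₃ a₄ *S a₃ ≋
    slideSumShape a₆ a₇ a₂ a₃ a₄ a₃ a₂ +S (slideSumShape a₈ a₉ a₁ a₂ a₃ a₂ a₁
    +S (slideSumShape a₇ a₈ a₂ a₃ a₄ a₂ a₁ +S (slideSumShape a₆ a₇ a₃ a₄ a₅ a₂ a₁
    +S (slideSumShape a₆ a₇ a₄ a₅ a₆ a₁ a₀ +S slideSumShape a₆ a₇ a₅ a₆ a₇ a₀ a₋₁))))
  identity = solve 11 (λ a₋₁ a₀ a₁ a₂ a₃ a₄ a₅ a₆ a₇ a₈ a₉ →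
    Poly.det₂ a₅ a₇ a₁ a₃ :* a₄ :- Poly.det₂ a₅ a₆ a₃ a₄ :* a₃ :=
    Poly.slideSumShape a₆ a₇ a₂ a₃ a₄ a₃ a₂ :+ (Poly.slideSumShape a₈ a₉ a₁ a₂ a₃ a₂ a₁
    :+ (Poly.slideSumShape a₇ a₈ a₂ a₃ a₄ a₂ a₁ :+ (Poly.slideSumShape a₆ a₇ a₃ a₄ a₅ a₂ a₁
    :+ (Poly.slideSumShape a₆ a₇ a₄ a₅ a₆ a₁ a₀ :+ Poly.slideSumShape a₆ a₇ a₅ a₆ a₇ a₀ a₋₁))))) ≋-refl

h-↗ : ∀ z → AllSorted (h z)
h-↗ (+ zero) = [] ∷ []
h-↗ (+ suc m) = [-] ∷ []
h-↗ -[1+ m ] = []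

sumS-map-↗ : ∀ {A : Set} (f : A → Sym) xs → (∀ x → AllSorted (f x)) → AllSorted (sumS (map f xs))
sumS-map-↗ f [] f↗ = []
sumS-map-↗ f (x ∷ xs) f↗ = AllP.++⁺ (f↗ x) (sumS-map-↗ f xs f↗)

det-↗ : ∀ n M → (∀ a b → AllSorted (M a b)) → AllSorted (det n M)
det-↗ zero M M↗ = [] ∷ []
det-↗ (suc n) M M↗ = sumS-map-↗ _ (allFinL (suc n)) λ j →
  scaleS-↗ (sign (toℕ j)) (*S-↗ (M fzero j) (det-↗ n _ (λ a b → M↗ (fsuc a) (punchIn j b))))

skewSchur-↗ : ∀ λ′ μ → AllSorted (skewSchur λ′ μ)
skewSchur-↗ λ′ μ = det-↗ (length λ′) _ (λ a b → h-↗ _)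

schurCombination-↗ : ∀ L → AllSorted (schurCombination L)
schurCombination-↗ L = sumS-map-↗ _ L (λ t → scaleS-↗ (+ proj₂ t) (skewSchur-↗ (proj₁ t) []))

schurDifference-↗ : ∀ i → AllSorted (schurDifference i)
schurDifference-↗ i = AllP.++⁺
  (*S-↗ (skewSchur (i + 3 ∷ i ∷ []) (1 ∷ [])) (skewSchur-↗ (suc i ∷ []) []))
  (scaleS-↗ ℤ.-1ℤ (*S-↗ (schur (i + 2 ∷ suc i ∷ [])) (skewSchur-↗ (i ∷ []) [])))

slideFamily-partitions : ∀ E B Z → B ≤ E → Z ≤ B → All (λ t → IsPartition (proj₁ t)) (slideFamily E B Z)
slideFamily-partitions E B zero B≤E _ = consᵖ B≤E (consᵖ z≤n [ 0 ]ᵖ) ∷ []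
slideFamily-partitions E B (suc Z) B≤E 1+Z≤B =
  consᵖ B≤E (consᵖ 1+Z≤B [ suc Z ]ᵖ)
    ∷ slideFamily-partitions (suc E) B Z (ℕP.m≤n⇒m≤1+n B≤E) (ℕP.≤-trans (ℕP.n≤1+n Z) 1+Z≤B)

sixFamilies-partitions : ∀ j → All (λ t → IsPartition (proj₁ t)) (sixFamilies j)
sixFamilies-partitions j =
  AllP.++⁺ (slideFamily-partitions (6 + j) (3 + j) (3 + j) (ℕP.m≤n+m _ 3) ℕP.≤-refl)
  (AllP.++⁺ (slideFamily-partitions (8 + j) (2 + j) (2 + j) (ℕP.m≤n+m _ 6) ℕP.≤-refl)
  (AllP.++⁺ (slideFamily-partitions (7 + j) (3 + j) (2 + j) (ℕP.m≤n+m _ 4) (ℕP.m≤n+m _ 1))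
  (AllP.++⁺ (slideFamily-partitions (6 + j) (4 + j) (2 + j) (ℕP.m≤n+m _ 2) (ℕP.m≤n+m _ 2))
  (AllP.++⁺ (slideFamily-partitions (6 + j) (5 + j) (1 + j) (ℕP.m≤n+m _ 1) (ℕP.m≤n+m _ 4))
            (slideFamily-partitions (6 + j) (6 + j) j ℕP.≤-refl (ℕP.m≤n+m _ 6))))))

isPartition? : ∀ l → Dec (IsPartition l)
isPartition? [] = yes []ᵖ
isPartition? (a ∷ []) = yes [ a ]ᵖ
isPartition? (a ∷ b ∷ l) = Dec.map′ (λ (b≤a , p) → consᵖ b≤a p) (λ { (consᵖ b≤a p) → b≤a , p })
                                    (b ≤? a ×-dec isPartition? (b ∷ l))

≈S? : ∀ p q → Dec (All (λ ν → coeff p ν ≡ coeff q ν) (map proj₁ p ++ map proj₁ q))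
≈S? p q = All.all? (λ ν → coeff p ν ℤ.≟ coeff q ν) (map proj₁ p ++ map proj₁ q)

coeff-outside-support : ∀ p ν → ¬ ν ∈ map proj₁ p → coeff p ν ≡ + 0
coeff-outside-support [] ν ν∉p = refl
coeff-outside-support ((m , a) ∷ p) ν ν∉p with ≡-dec ℕ._≟_ m ν
... | yes refl = ⊥-elim (ν∉p (here refl))
... | no _ = coeff-outside-support p ν (λ ν∈p → ν∉p (there ν∈p))

≈S-on-supports : ∀ p q → All (λ ν → coeff p ν ≡ coeff q ν) (map proj₁ p ++ map proj₁ q) → p ≈S q
≈S-on-supports p q agree ν with ν ∈? (map proj₁ p ++ map proj₁ q)
... | yes ν∈ = All.lookup agree ν∈
... | no ν∉ = trans (coeff-outside-support p ν (λ ν∈p → ν∉ (∈-++⁺ˡ ν∈p)))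
                    (sym (coeff-outside-support q ν (λ ν∈q → ν∉ (∈-++⁺ʳ (map proj₁ p) ν∈q))))

schurPositive-byComputation : ∀ f L → True (All.all? (λ t → isPartition? (proj₁ t)) L) →
  True (≈S? f (schurCombination L)) → SchurPositive f
schurPositive-byComputation f L parts agree =
  L , toWitness parts , ≈S-on-supports f (schurCombination L) (toWitness agree)

schurPositive-via-≋ : ∀ {f} L → AllSorted f → All (λ t → IsPartition (proj₁ t)) L →
  f ≋ schurCombination L → SchurPositive f
schurPositive-via-≋ L f↗ parts f≋L = L , parts , ≋⇒≈S f↗ (schurCombination-↗ L) f≋L

mainTheorem2 : (i : ℕ) →
    SchurPositive
      (skewSchur (i + 3 ∷ i ∷ []) (1 ∷ []) *S schur (suc i ∷ [])
        -S schur (i + 2 ∷ suc i ∷ []) *S schur (i ∷ []))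
mainTheorem2 0 = schurPositive-byComputation (schurDifference 0) (((3 ∷ []) , 1) ∷ []) tt tt
mainTheorem2 1 = schurPositive-byComputation (schurDifference 1)
  (((4 ∷ 1 ∷ 1 ∷ []) , 1) ∷ ((4 ∷ 2 ∷ []) , 1) ∷ ((5 ∷ 1 ∷ []) , 2) ∷ ((6 ∷ []) , 1) ∷ []) tt tt
mainTheorem2 2 = schurPositive-byComputation (schurDifference 2)
  (((5 ∷ 2 ∷ 2 ∷ []) , 1) ∷ ((5 ∷ 3 ∷ 1 ∷ []) , 1) ∷ ((5 ∷ 4 ∷ []) , 1) ∷ ((6 ∷ 2 ∷ 1 ∷ []) , 2)
   ∷ ((6 ∷ 3 ∷ []) , 1) ∷ ((7 ∷ 1 ∷ 1 ∷ []) , 1) ∷ ((7 ∷ 2 ∷ []) , 2) ∷ ((8 ∷ 1 ∷ []) , 1) ∷ []) tt tt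
mainTheorem2 (suc (suc (suc j))) =
  schurPositive-via-≋ (sixFamilies j) (schurDifference-↗ (3 + j)) (sixFamilies-partitions j)
    (schurDifference≋sixFamilies j)
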